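{- Let $n\geq 1$ and $\alpha\in\{0,1\}^{n-1}$. Then the map $f_{\alpha}:P_{2n}\to P_{2n}$ satisfies $f_{\alpha}(D_{2n}^{=0}(n))=D_{2n}^{=0}(n)$ and $f_{\alpha}(D_{2n}^{ - }(n))=D_{2n}^{ - }(n)$.
   Context: For $m\geq 0$, $P_m$ denotes the set of lattice paths in $\mathbb{Z}^2$ starting at $(0,0)$ and consisting of $m$ steps, each being an upstep $(+1,+1)$ or a downstep $(+1,-1)$. $D_{2n}^{=0}(n)$ is the set of paths in $P_{2n}$ with exactly $n$ upsteps that never go below the line $y=0$ (so they end at $(2n,0)$) and touch $y=0$ at some abscissa $x$ with $1\leq x\leq 2n$ (i.e. Dyck paths of length $2n$). $D_{2n}^{ - }(n)$ is the set of paths in $P_{2n}$ with exactly $n$ upsteps that have exactly one point with negative $y$-coordinate, this point being of the form $(x,-1)$ with $1\leq x\leq 2n$. Paths in $P_{2n}$ are identified with bitstrings of length $2n$ via the bijection $\varphi$: the $i$-th step is an upstep iff the $i$-th bit is $1$. For $\alpha=(\alpha(1),\ldots,\alpha(n-1))\in\{0,1\}^{n-1}$, let $\pi_\alpha$ be the permutation of bitstrings of length $2n$ that swaps the bits at positions $2i$ and $2i+1$ for every $i=1,\ldots,n-1$ with $\alpha(i)=1$ (and leaves all other bits, including positions $1$ and $2n$, in place). Define $f_\alpha(x):=\overline{\mathrm{rev}(\pi_\alpha(x))}$, where $\mathrm{rev}$ reverses a bitstring and the overline complements every bit. $f_\alpha$ is transferred to $P_{2n}$ via $\varphi$, i.e.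 $f_\alpha:=\varphi\circ f_\alpha\circ\varphi^{ -1}$. -}

module Defs where

open import Data.Bool using (Bool; true; false; not; if_then_else_)
open import Data.Nat using (ℕ; zero; suc; _*_; _≤_; _∸_)
open import Data.List using (List; []; _∷_; _++_; length; reverse; map; take; filter)
open import Data.Vec using (Vec; toList)
open import Data.Integer using (ℤ; +_; -_; -[1+_]) renaming (_+_ to _+ℤ_; _≤_ to _≤ℤ_; _<_ to _<ℤ_)
open import Data.Product using (Σ; _×_; ∃)
open import Relation.Binary.PropositionalEquality using (_≡_)

-- A path in P_m is identified (via φ) with a bitstring of length m; true = upstep.

height : List Bool → ℤ
height []           = + 0
height (true ∷ bs)  = + 1 +ℤ height bs
height (false ∷ bs) = -[1+ 0 ] +ℤ height bs

yAt : List Bool → ℕ → ℤ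
yAt p x = height (take x p)

ups : List Bool → ℕ
ups []           = 0
ups (true ∷ bs)  = suc (ups bs)
ups (false ∷ bs) = ups bs

InD0 : ℕ → List Bool → Set
InD0 n p =
  length p ≡ 2 * n × ups p ≡ n
  × (∀ x → x ≤ 2 * n → + 0 ≤ℤ yAt p x)
  × ∃ (λ x → 1 ≤ x × x ≤ 2 * n × yAt p x ≡ + 0)

InDminus : ℕ → List Bool → Set
InDminus n p =
  length p ≡ 2 * n × ups p ≡ n
  × ∃ (λ x → 1 ≤ x × x ≤ 2 * n × yAt p x ≡ -[1+ 0 ]
        × (∀ y → y ≤ 2 * n → yAt p y <ℤ + 0 → y ≡ x))

swapPairs : List Bool → List Bool → List Bool
swapPairs (a ∷ as) (x ∷ y ∷ rest) = (if a then y ∷ x ∷ [] else x ∷ y ∷ []) ++ swapPairs as rest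
swapPairs _ xs = xs

πα : List Bool → List Bool → List Bool
πα α []       = []
πα α (b ∷ bs) = b ∷ swapPairs α bs

fα : List Bool → List Bool → List Bool
fα α x = map not (reverse (πα α x))

ImageEq : (List Bool → List Bool) → (List Bool → Set) → Set
ImageEq f D = (∀ p → D p → D (f p)) × (∀ q → D q → Σ (List Bool) (λ p → D p × f p ≡ q))

module Submission where

-- Write rc p for the reverse-complement of p, so that
-- f_α = rc ∘ π_α.  We show that π_α and rc each map D⁼⁰ and D⁻ into
-- themselves, hence so does f_α; surjectivity then follows because
-- f_α ∘ f_{rev α} is the identity on bitstrings of length 2n.
--
-- Membership in D⁼⁰ and D⁻ is first translated into arithmetic on ℕ: if
-- u_k counts the upsteps among the first k steps, the height at abscissa k
-- is 2u_k − k.  Then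
--  * π_α only permutes steps inside the blocks {2i, 2i+1}, so it keeps u_k
--    at every odd k, and at an even k the new count is squeezed between
--    the old counts at k − 1 and k + 1; parity does the rest;
--  * rc reflects the path: 2u'_k + k' = 2u_{k'} + k whenever k + k' = 2n,
--    so every height condition at k' transfers to the mirror abscissa k.

open import Defs
open import Data.Bool using (Bool; true; false; not; if_then_else_)
open import Data.Bool.Properties using (not-involutive)
open import Data.Nat using (ℕ; zero; suc; _+_; _*_; _≤_; _<_; _∸_; z≤n; s≤s)
open import Data.Nat.Properties
open import Data.Nat.Tactic.RingSolver using (solve-∀)
open import Data.List using (List; []; _∷_; _++_; _∷ʳ_; [_]; length; reverse; map; take; drop)
open import Data.List.Properties
  using (++-identityʳ; ++-assoc; reverse-++; reverse-involutive; reverse-map; length-reverse;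
         length-take; take-all; length-map; take++drop≡id; length-drop; map-++; map-∘; map-cong; map-id)
open import Data.Vec using (Vec; toList)
open import Data.Vec.Properties using (length-toList)
open import Data.Product using (Σ; ∃₂; _×_; _,_; proj₁; proj₂)
open import Data.Sum using (_⊎_; inj₁; inj₂)
open import Function using (_∘_)
open import Relation.Nullary using (¬_; contradiction)
open import Data.Integer using (+_; -[1+_]; _⊖_; +≤+; +<+; -<+) renaming (_+_ to _+ℤ_; _≤_ to _≤ℤ_; _<_ to _<ℤ_)
open import Data.Integer.Properties using ([1+m]⊖[1+n]≡m⊖n; distribʳ-⊖-+-pos; distribʳ-⊖-+-neg; n⊖n≡0)
open import Relation.Binary.PropositionalEquality hiding ([_])

-- double j = 2j, by a recursion that matches the blocks of two steps.
double : ℕ → ℕ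
double zero    = zero
double (suc j) = suc (suc (double j))

double≡2* : ∀ j → double j ≡ 2 * j
double≡2* zero    = refl
double≡2* (suc j) = trans (cong (suc ∘ suc) (double≡2* j)) (sym (*-distribˡ-+ 2 1 j))

double-mono : ∀ {v w} → v ≤ w → double v ≤ double w
double-mono z≤n     = z≤n
double-mono (s≤s h) = s≤s (s≤s (double-mono h))

parity : ∀ x → Σ ℕ λ j → x ≡ double j ⊎ x ≡ suc (double j)
parity zero = 0 , inj₁ refl
parity (suc x) with parity x
... | j , inj₁ refl = j , inj₂ refl
... | j , inj₂ refl = suc j , inj₁ refl

odd≤double : ∀ j w → suc (double j) ≤ double w → suc (suc (double j)) ≤ double w
odd≤double zero    (suc w) _                 = s≤s (s≤s z≤n)
odd≤double (suc j) (suc w) (s≤s (s≤s h)) = s≤s (s≤s (odd≤double j w h))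

double<⇒ : ∀ v j → double v < suc (suc (double j)) → v ≤ j
double<⇒ zero    j       _                 = z≤n
double<⇒ (suc v) (suc j) (s≤s (s≤s h)) = s≤s (double<⇒ v j h)
double<⇒ (suc v) zero    (s≤s (s≤s ()))

-- Transferring conditions through a balance a + b = c + d; this is how the
-- mirror identity for rc is used.
balance-≤ : ∀ {a b c d} → a + b ≡ c + d → b ≤ c → d ≤ a
balance-≤ {a} {b} {c} {d} e b≤c = +-cancelˡ-≤ b d a (begin
  b + d  ≡⟨ +-comm b d ⟩
  d + b  ≤⟨ +-monoʳ-≤ d b≤c ⟩
  d + c  ≡⟨ +-comm d c ⟩
  c + d  ≡⟨ sym e ⟩
  a + b  ≡⟨ +-comm a b ⟩
  b + a  ∎)
  where open ≤-Reasoning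

balance-< : ∀ {a b c d} → a + b ≡ c + d → a < d → c < b
balance-< {a} {b} {c} {d} e a<d = +-cancelˡ-< d c b (begin-strict
  d + c  ≡⟨ +-comm d c ⟩
  c + d  ≡⟨ sym e ⟩
  a + b  <⟨ +-monoˡ-< b a<d ⟩
  d + b  ∎)
  where open ≤-Reasoning

balance-suc : ∀ {a b c d} → a + b ≡ c + d → suc c ≡ b → suc a ≡ d
balance-suc {a} {b} {c} {d} e s = +-cancelʳ-≡ c (suc a) d (begin
  suc a + c  ≡⟨ sym (+-suc a c) ⟩
  a + suc c  ≡⟨ cong (_+_ a) s ⟩
  a + b      ≡⟨ e ⟩
  c + d      ≡⟨ +-comm c d ⟩
  d + c      ∎)
  where open ≡-Reasoning

swapPair : Bool → Bool → Bool → List Bool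
swapPair e x y = if e then y ∷ x ∷ [] else x ∷ y ∷ []

length-swapPairs : ∀ a bs → length (swapPairs a bs) ≡ length bs
length-swapPairs []          bs          = refl
length-swapPairs (e ∷ a)     []          = refl
length-swapPairs (e ∷ a)     (x ∷ [])    = refl
length-swapPairs (true ∷ a)  (x ∷ y ∷ r) = cong (suc ∘ suc) (length-swapPairs a r)
length-swapPairs (false ∷ a) (x ∷ y ∷ r) = cong (suc ∘ suc) (length-swapPairs a r)

swapPairs-involutive : ∀ a bs → swapPairs a (swapPairs a bs) ≡ bs
swapPairs-involutive []          bs          = refl
swapPairs-involutive (e ∷ a)     []          = refl
swapPairs-involutive (e ∷ a)     (x ∷ [])    = refl
swapPairs-involutive (true ∷ a)  (x ∷ y ∷ r) = cong (λ t → x ∷ y ∷ t) (swapPairs-involutive a r)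
swapPairs-involutive (false ∷ a) (x ∷ y ∷ r) = cong (λ t → x ∷ y ∷ t) (swapPairs-involutive a r)

swapPairs-map-not : ∀ a bs → swapPairs a (map not bs) ≡ map not (swapPairs a bs)
swapPairs-map-not []          bs          = refl
swapPairs-map-not (e ∷ a)     []          = refl
swapPairs-map-not (e ∷ a)     (x ∷ [])    = refl
swapPairs-map-not (true ∷ a)  (x ∷ y ∷ r) = cong (λ t → not y ∷ not x ∷ t) (swapPairs-map-not a r)
swapPairs-map-not (false ∷ a) (x ∷ y ∷ r) = cong (λ t → not x ∷ not y ∷ t) (swapPairs-map-not a r)

swapPairs-++ : ∀ a s t → length s ≡ double (length a) → swapPairs a (s ++ t) ≡ swapPairs a s ++ t
swapPairs-++ []      []          t refl = refl
swapPairs-++ (e ∷ a) (x ∷ y ∷ s) t len =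
  trans (cong (swapPair e x y ++_) (swapPairs-++ a s t (suc-injective (suc-injective len))))
        (sym (++-assoc (swapPair e x y) (swapPairs a s) t))

swapPairs-snoc : ∀ a e s x y → length s ≡ double (length a) →
  swapPairs (a ∷ʳ e) (s ++ x ∷ y ∷ []) ≡ swapPairs a s ++ swapPair e x y
swapPairs-snoc []      e []          x y refl = ++-identityʳ (swapPair e x y)
swapPairs-snoc (c ∷ a) e (u ∷ v ∷ s) x y len =
  trans (cong (swapPair c u v ++_) (swapPairs-snoc a e s x y (suc-injective (suc-injective len))))
        (sym (++-assoc (swapPair c u v) (swapPairs a s) (swapPair e x y)))

reverse-swapPair : ∀ e x y → reverse (swapPair e x y) ≡ swapPair e y x
reverse-swapPair true  x y = refl
reverse-swapPair false x y = refl

swapPairs-reverse : ∀ a s → length s ≡ double (length a) →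
  swapPairs (reverse a) (reverse s) ≡ reverse (swapPairs a s)
swapPairs-reverse []      []          refl = refl
swapPairs-reverse (e ∷ a) (x ∷ y ∷ s) len = begin
    swapPairs (reverse (e ∷ a)) (reverse (x ∷ y ∷ s))
  ≡⟨ cong₂ swapPairs (reverse-++ [ e ] a) (reverse-++ (x ∷ y ∷ []) s) ⟩
    swapPairs (reverse a ∷ʳ e) (reverse s ++ y ∷ x ∷ [])
  ≡⟨ swapPairs-snoc (reverse a) e (reverse s) y x len′ ⟩
    swapPairs (reverse a) (reverse s) ++ swapPair e y x
  ≡⟨ cong₂ _++_ (swapPairs-reverse a s len-s) (sym (reverse-swapPair e x y)) ⟩
    reverse (swapPairs a s) ++ reverse (swapPair e x y)
  ≡⟨ sym (reverse-++ (swapPair e x y) (swapPairs a s)) ⟩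
    reverse (swapPair e x y ++ swapPairs a s)
  ∎
  where
  open ≡-Reasoning
  len-s : length s ≡ double (length a)
  len-s = suc-injective (suc-injective len)
  len′ : length (reverse s) ≡ double (length (reverse a))
  len′ = trans (length-reverse s) (trans len-s (cong double (sym (length-reverse a))))

splitLast : ∀ (q : List Bool) {k} → length q ≡ suc k → ∃₂ λ s z → q ≡ s ∷ʳ z × length s ≡ k
splitLast (x ∷ [])    refl = [] , x , refl , refl
splitLast (x ∷ y ∷ r) refl with splitLast (y ∷ r) refl
... | s , z , eq , len = x ∷ s , z , cong (x ∷_) eq , cong suc len

reverse-cons-snoc : ∀ (b : Bool) s z → reverse (b ∷ s ∷ʳ z) ≡ z ∷ reverse s ∷ʳ b
reverse-cons-snoc b s z = trans (reverse-++ (b ∷ s) [ z ]) (cong (z ∷_) (reverse-++ [ b ] s))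

πα-reverse : ∀ a R → length R ≡ suc (suc (double (length a))) →
  πα a (reverse R) ≡ reverse (πα (reverse a) R)
πα-reverse a (b ∷ rest) len with splitLast rest (suc-injective len)
... | s , z , refl , len-s = begin
    πα a (reverse (b ∷ s ∷ʳ z))
  ≡⟨ cong (πα a) (reverse-cons-snoc b s z) ⟩
    z ∷ swapPairs a (reverse s ∷ʳ b)
  ≡⟨ cong (z ∷_) (swapPairs-++ a (reverse s) [ b ] (trans (length-reverse s) len-s)) ⟩
    z ∷ swapPairs a (reverse s) ∷ʳ b
  ≡⟨ cong (λ t → z ∷ t ∷ʳ b) middle ⟩
    z ∷ reverse (swapPairs (reverse a) s) ∷ʳ b
  ≡⟨ sym (reverse-cons-snoc b (swapPairs (reverse a) s) z) ⟩
    reverse (b ∷ swapPairs (reverse a) s ∷ʳ z)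
  ≡⟨ cong (reverse ∘ (b ∷_)) (sym (swapPairs-++ (reverse a) s [ z ] len-s′)) ⟩
    reverse (πα (reverse a) (b ∷ s ∷ʳ z))
  ∎
  where
  open ≡-Reasoning
  len-s′ : length s ≡ double (length (reverse a))
  len-s′ = trans len-s (cong double (sym (length-reverse a)))
  middle : swapPairs a (reverse s) ≡ reverse (swapPairs (reverse a) s)
  middle = trans (cong (λ t → swapPairs t (reverse s)) (sym (reverse-involutive a)))
                 (swapPairs-reverse (reverse a) s len-s′)

length-πα : ∀ a p → length (πα a p) ≡ length p
length-πα a []      = refl
length-πα a (b ∷ p) = cong suc (length-swapPairs a p)

πα-involutive : ∀ a p → πα a (πα a p) ≡ p
πα-involutive a []      = refl
πα-involutive a (b ∷ p) = cong (b ∷_) (swapPairs-involutive a p)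

πα-map-not : ∀ a p → πα a (map not p) ≡ map not (πα a p)
πα-map-not a []      = refl
πα-map-not a (b ∷ p) = cong (not b ∷_) (swapPairs-map-not a p)

rc : List Bool → List Bool
rc p = map not (reverse p)

map-not-involutive : ∀ l → map not (map not l) ≡ l
map-not-involutive l = trans (sym (map-∘ l)) (trans (map-cong not-involutive l) (map-id l))

fα-section : ∀ a q → length q ≡ suc (suc (double (length a))) → fα a (fα (reverse a) q) ≡ q
fα-section a q len = begin
    map not (reverse (πα a (map not (reverse R))))
  ≡⟨ cong (map not ∘ reverse) (πα-map-not a (reverse R)) ⟩
    map not (reverse (map not (πα a (reverse R))))
  ≡⟨ cong (map not) (sym (reverse-map not (πα a (reverse R)))) ⟩
    map not (map not (reverse (πα a (reverse R))))
  ≡⟨ map-not-involutive _ ⟩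
    reverse (πα a (reverse R))
  ≡⟨ cong reverse (πα-reverse a R (trans (length-πα (reverse a) q) len)) ⟩
    reverse (reverse (πα (reverse a) R))
  ≡⟨ reverse-involutive _ ⟩
    πα (reverse a) R
  ≡⟨ πα-involutive (reverse a) q ⟩
    q
  ∎
  where
  open ≡-Reasoning
  R : List Bool
  R = πα (reverse a) q

upsTo : List Bool → ℕ → ℕ
upsTo p k = ups (take k p)

ups-cons : ∀ x {t t′} → ups t ≡ ups t′ → ups (x ∷ t) ≡ ups (x ∷ t′)
ups-cons true  e = cong suc e
ups-cons false e = e

ups-swap : ∀ x y {t t′} → ups t ≡ ups t′ → ups (y ∷ x ∷ t) ≡ ups (x ∷ y ∷ t′)
ups-swap true  true  e = cong (suc ∘ suc) e
ups-swap true  false e = cong suc e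
ups-swap false true  e = cong suc e
ups-swap false false e = e

ups-++ : ∀ xs ys → ups (xs ++ ys) ≡ ups xs + ups ys
ups-++ []           ys = refl
ups-++ (true ∷ xs)  ys = cong suc (ups-++ xs ys)
ups-++ (false ∷ xs) ys = ups-++ xs ys

ups-reverse : ∀ l → ups (reverse l) ≡ ups l
ups-reverse []      = refl
ups-reverse (x ∷ l) = begin
  ups (reverse (x ∷ l))        ≡⟨ cong ups (reverse-++ [ x ] l) ⟩
  ups (reverse l ++ [ x ])     ≡⟨ ups-++ (reverse l) [ x ] ⟩
  ups (reverse l) + ups [ x ]  ≡⟨ cong (_+ ups [ x ]) (ups-reverse l) ⟩
  ups l + ups [ x ]            ≡⟨ +-comm (ups l) (ups [ x ]) ⟩
  ups [ x ] + ups l            ≡⟨ ups-++ [ x ] l ⟨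
  ups (x ∷ l)                  ∎
  where open ≡-Reasoning

ups-map-not : ∀ l → ups (map not l) + ups l ≡ length l
ups-map-not []          = refl
ups-map-not (true ∷ l)  = trans (+-suc _ _) (cong suc (ups-map-not l))
ups-map-not (false ∷ l) = cong suc (ups-map-not l)

ups-swapPairs : ∀ a bs → ups (swapPairs a bs) ≡ ups bs
ups-swapPairs []          bs          = refl
ups-swapPairs (e ∷ a)     []          = refl
ups-swapPairs (e ∷ a)     (x ∷ [])    = refl
ups-swapPairs (true ∷ a)  (x ∷ y ∷ r) = ups-swap x y (ups-swapPairs a r)
ups-swapPairs (false ∷ a) (x ∷ y ∷ r) = ups-cons x (ups-cons y (ups-swapPairs a r))

ups-πα : ∀ a p → ups (πα a p) ≡ ups p
ups-πα a []      = refl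
ups-πα a (b ∷ l) = ups-cons b (ups-swapPairs a l)

upsTo-swapPairs : ∀ a bs j → upsTo (swapPairs a bs) (double j) ≡ upsTo bs (double j)
upsTo-swapPairs []          bs          j       = refl
upsTo-swapPairs (e ∷ a)     []          j       = refl
upsTo-swapPairs (e ∷ a)     (x ∷ [])    j       = refl
upsTo-swapPairs (e ∷ a)     (x ∷ y ∷ r) zero    = refl
upsTo-swapPairs (true ∷ a)  (x ∷ y ∷ r) (suc j) = ups-swap x y (upsTo-swapPairs a r j)
upsTo-swapPairs (false ∷ a) (x ∷ y ∷ r) (suc j) = ups-cons x (ups-cons y (upsTo-swapPairs a r j))

upsTo-πα-odd : ∀ a p j → upsTo (πα a p) (suc (double j)) ≡ upsTo p (suc (double j))
upsTo-πα-odd a []      j = refl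
upsTo-πα-odd a (b ∷ l) j = ups-cons b (upsTo-swapPairs a l j)

upsTo-≤suc : ∀ p k → upsTo p k ≤ upsTo p (suc k)
upsTo-≤suc p           zero    = z≤n
upsTo-≤suc []          (suc k) = z≤n
upsTo-≤suc (true ∷ p)  (suc k) = s≤s (upsTo-≤suc p k)
upsTo-≤suc (false ∷ p) (suc k) = upsTo-≤suc p k

upsTo-suc≤ : ∀ p k → upsTo p (suc k) ≤ suc (upsTo p k)
upsTo-suc≤ []          zero    = z≤n
upsTo-suc≤ []          (suc k) = z≤n
upsTo-suc≤ (true ∷ p)  zero    = s≤s z≤n
upsTo-suc≤ (false ∷ p) zero    = z≤n
upsTo-suc≤ (true ∷ p)  (suc k) = s≤s (upsTo-suc≤ p k)
upsTo-suc≤ (false ∷ p) (suc k) = upsTo-suc≤ p k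

upsTo-πα-even : ∀ a p j →
  upsTo p (suc (double j)) ≤ upsTo (πα a p) (double (suc j)) ×
  upsTo p (suc (double (suc j))) ≤ suc (upsTo (πα a p) (double (suc j)))
upsTo-πα-even a p j =
  subst (_≤ upsTo q (double (suc j))) (upsTo-πα-odd a p j) (upsTo-≤suc q (suc (double j))) ,
  subst (_≤ suc (upsTo q (double (suc j)))) (upsTo-πα-odd a p (suc j)) (upsTo-suc≤ q (double (suc j)))
  where
  q : List Bool
  q = πα a p

upsTo-all : ∀ p {L} → length p ≡ L → upsTo p L ≡ ups p
upsTo-all p e = cong ups (take-all _ p (≤-reflexive e))

-- The last k steps of rc p are the reverse-complement of the first k steps
-- of p; counting upsteps gives the mirror identity for up-counts.
upsTo-rc : ∀ p k → k ≤ length p → upsTo (rc p) k + ups p ≡ k + upsTo p (length p ∸ k)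
upsTo-rc p k k≤ = begin
    ups (take k (rc p)) + ups p
  ≡⟨ cong₂ _+_ (cong ups take-rc) (trans (cong ups (sym (take++drop≡id m p))) (ups-++ A B)) ⟩
    ups (rc B) + (ups A + ups B)
  ≡⟨ cong (_+_ (ups (rc B))) (+-comm (ups A) (ups B)) ⟩
    ups (rc B) + (ups B + ups A)
  ≡⟨ +-assoc (ups (rc B)) (ups B) (ups A) ⟨
    ups (rc B) + ups B + ups A
  ≡⟨ cong (λ t → ups (rc B) + t + ups A) (ups-reverse B) ⟨
    ups (rc B) + ups (reverse B) + ups A
  ≡⟨ cong (_+ ups A) (trans (ups-map-not (reverse B)) (trans (length-reverse B) len-B)) ⟩
    k + ups A
  ∎
  where
  open ≡-Reasoning
  m : ℕ
  m = length p ∸ k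
  A B : List Bool
  A = take m p
  B = drop m p
  len-B : length B ≡ k
  len-B = trans (length-drop m p) (m∸[m∸n]≡n k≤)
  take-exact : ∀ (xs ys : List Bool) {n} → length xs ≡ n → take n (xs ++ ys) ≡ xs
  take-exact []       ys refl = refl
  take-exact (x ∷ xs) ys refl = cong (x ∷_) (take-exact xs ys refl)
  take-rc : take k (rc p) ≡ rc B
  take-rc = begin
      take k (rc p)
    ≡⟨ cong (take k ∘ rc) (take++drop≡id m p) ⟨
      take k (map not (reverse (A ++ B)))
    ≡⟨ cong (take k ∘ map not) (reverse-++ A B) ⟩
      take k (map not (reverse B ++ reverse A))
    ≡⟨ cong (take k) (map-++ not (reverse B) (reverse A)) ⟩
      take k (rc B ++ rc A)
    ≡⟨ take-exact (rc B) (rc A) (trans (length-map not (reverse B)) (trans (length-reverse B) len-B)) ⟩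
      rc B
    ∎

height≡ : ∀ l → height l ≡ double (ups l) ⊖ length l
height≡ []          = refl
height≡ (true ∷ l)  =
  trans (cong (+ 1 +ℤ_) (height≡ l))
        (trans (distribʳ-⊖-+-pos 1 (double (ups l)) (length l))
               (sym ([1+m]⊖[1+n]≡m⊖n (suc (double (ups l))) (length l))))
height≡ (false ∷ l) =
  trans (cong (-[1+ 0 ] +ℤ_) (height≡ l)) (distribʳ-⊖-+-neg 0 (double (ups l)) (length l))

yAt≡ : ∀ p {k} → k ≤ length p → yAt p k ≡ double (upsTo p k) ⊖ k
yAt≡ p {k} k≤ = trans (height≡ (take k p))
  (cong (double (upsTo p k) ⊖_) (trans (length-take k p) (m≤n⇒m⊓n≡m k≤)))

⊖-nonneg⇒ : ∀ m n → + 0 ≤ℤ m ⊖ n → n ≤ m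
⊖-nonneg⇒ m       zero    _ = z≤n
⊖-nonneg⇒ zero    (suc n) ()
⊖-nonneg⇒ (suc m) (suc n) h = s≤s (⊖-nonneg⇒ m n (subst (+ 0 ≤ℤ_) ([1+m]⊖[1+n]≡m⊖n m n) h))

⊖-nonneg⇐ : ∀ {m n} → n ≤ m → + 0 ≤ℤ m ⊖ n
⊖-nonneg⇐ z≤n                   = +≤+ z≤n
⊖-nonneg⇐ {suc m} {suc n} (s≤s h) = subst (+ 0 ≤ℤ_) (sym ([1+m]⊖[1+n]≡m⊖n m n)) (⊖-nonneg⇐ h)

⊖-neg⇒ : ∀ m n → m ⊖ n <ℤ + 0 → m < n
⊖-neg⇒ zero    zero    (+<+ ())
⊖-neg⇒ (suc m) zero    (+<+ ())
⊖-neg⇒ zero    (suc n) _ = s≤s z≤n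
⊖-neg⇒ (suc m) (suc n) h = s≤s (⊖-neg⇒ m n (subst (_<ℤ + 0) ([1+m]⊖[1+n]≡m⊖n m n) h))

⊖-neg⇐ : ∀ {m n} → m < n → m ⊖ n <ℤ + 0
⊖-neg⇐ {zero}  {suc n} _       = -<+
⊖-neg⇐ {suc m} {suc n} (s≤s h) = subst (_<ℤ + 0) (sym ([1+m]⊖[1+n]≡m⊖n m n)) (⊖-neg⇐ h)

⊖-minus1⇒ : ∀ m n → m ⊖ n ≡ -[1+ 0 ] → suc m ≡ n
⊖-minus1⇒ zero    zero          ()
⊖-minus1⇒ zero    (suc zero)    _ = refl
⊖-minus1⇒ zero    (suc (suc n)) ()
⊖-minus1⇒ (suc m) zero          ()
⊖-minus1⇒ (suc m) (suc n)       e = cong suc (⊖-minus1⇒ m n (trans (sym ([1+m]⊖[1+n]≡m⊖n m n)) e))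

⊖-minus1⇐ : ∀ m → m ⊖ suc m ≡ -[1+ 0 ]
⊖-minus1⇐ zero    = refl
⊖-minus1⇐ (suc m) = trans ([1+m]⊖[1+n]≡m⊖n m (suc m)) (⊖-minus1⇐ m)

Balanced : ℕ → List Bool → Set
Balanced n p = length p ≡ 2 * n × ups p ≡ n

-- The point of p at abscissa x is on or above the axis / strictly below it /
-- at height −1.
Above Below Dip : List Bool → ℕ → Set
Above p x = x ≤ double (upsTo p x)
Below p x = double (upsTo p x) < x
Dip   p x = suc (double (upsTo p x)) ≡ x

IsDyck : ℕ → List Bool → Set
IsDyck n p = Balanced n p × (∀ x → x ≤ 2 * n → Above p x)

IsDyck₋ : ℕ → List Bool → Set
IsDyck₋ n p = Balanced n p × Σ ℕ λ x → 1 ≤ x × x ≤ 2 * n × Dip p x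
                × (∀ y → y ≤ 2 * n → Below p y → y ≡ x)

balanced-end : ∀ {n p} → Balanced n p → double (upsTo p (2 * n)) ≡ 2 * n
balanced-end {n} {p} (len , up) = trans (cong double (trans (upsTo-all p len) up)) (double≡2* n)

balanced-¬below-end : ∀ {n p} → Balanced n p → ¬ Below p (2 * n)
balanced-¬below-end bal below = <-irrefl (balanced-end bal) below

within : ∀ (p : List Bool) {x L} → length p ≡ L → x ≤ L → x ≤ length p
within p len x≤ = ≤-trans x≤ (≤-reflexive (sym len))

InD0⇒IsDyck : ∀ n p → InD0 n p → IsDyck n p
InD0⇒IsDyck n p (len , up , nonneg , _) = (len , up) , λ x x≤ →
  ⊖-nonneg⇒ _ _ (subst (+ 0 ≤ℤ_) (yAt≡ p (within p len x≤)) (nonneg x x≤))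

IsDyck⇒InD0 : ∀ n p → 1 ≤ n → IsDyck n p → InD0 n p
IsDyck⇒InD0 n p 1≤n ((len , up) , above) =
  len , up ,
  (λ x x≤ → subst (+ 0 ≤ℤ_) (sym (yAt≡ p (within p len x≤))) (⊖-nonneg⇐ (above x x≤))) ,
  (2 * n , ≤-trans 1≤n (m≤m+n n (n + 0)) , ≤-refl , touches-end)
  where
  touches-end : yAt p (2 * n) ≡ + 0
  touches-end = trans (yAt≡ p (within p len ≤-refl))
    (trans (cong (_⊖ 2 * n) (balanced-end {n} (len , up))) (n⊖n≡0 (2 * n)))

InDminus⇒IsDyck₋ : ∀ n p → InDminus n p → IsDyck₋ n p
InDminus⇒IsDyck₋ n p (len , up , x , 1≤x , x≤ , minus1 , unique) =
  (len , up) , x , 1≤x , x≤ ,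
  ⊖-minus1⇒ _ _ (trans (sym (yAt≡ p (within p len x≤))) minus1) ,
  λ y y≤ below → unique y y≤ (subst (_<ℤ + 0) (sym (yAt≡ p (within p len y≤))) (⊖-neg⇐ below))

IsDyck₋⇒InDminus : ∀ n p → IsDyck₋ n p → InDminus n p
IsDyck₋⇒InDminus n p ((len , up) , x , 1≤x , x≤ , dip , unique) =
  len , up , x , 1≤x , x≤ ,
  trans (yAt≡ p (within p len x≤))
        (subst (λ t → double (upsTo p x) ⊖ t ≡ -[1+ 0 ]) dip (⊖-minus1⇐ (double (upsTo p x)))) ,
  λ y y≤ neg → unique y y≤ (⊖-neg⇒ _ _ (subst (_<ℤ + 0) (yAt≡ p (within p len y≤)) neg))

πα-balanced : ∀ {n} a p → Balanced n p → Balanced n (πα a p)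
πα-balanced a p (len , up) = trans (length-πα a p) len , trans (ups-πα a p) up

-- Odd abscissas are unchanged; at an even abscissa 2j+2 the point 2j+1 of p
-- lies at height ≥ 1 (odd and nonnegative), so the new point stays ≥ 0.
πα-isDyck : ∀ {n} a p → IsDyck n p → IsDyck n (πα a p)
πα-isDyck {n} a p (bal , above) = πα-balanced a p bal , above′
  where
  above′ : ∀ x → x ≤ 2 * n → Above (πα a p) x
  above′ x x≤ with parity x
  ... | j     , inj₂ refl = subst (λ u → x ≤ double u) (sym (upsTo-πα-odd a p j)) (above x x≤)
  ... | zero  , inj₁ refl = z≤n
  ... | suc j , inj₁ refl =
    ≤-trans (odd≤double j _ (above (suc (double j)) (≤-trans (n≤1+n _) x≤)))
            (double-mono (proj₁ (upsTo-πα-even a p j)))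

-- The dip x of p is odd, so it survives; a new negative point at an even
-- abscissa 2j+2 < 2n would make both 2j+1 and 2j+3 negative in p, and 2n
-- itself is never negative.
πα-isDyck₋ : ∀ {n} a p → IsDyck₋ n p → IsDyck₋ n (πα a p)
πα-isDyck₋ {n} a p (bal , x , 1≤x , x≤ , dip , unique) =
  πα-balanced a p bal , x , 1≤x , x≤ , dip′ , unique′
  where
  q : List Bool
  q = πα a p
  -- x = 2u + 1 is odd, so π_α keeps the count u there.
  same-count : upsTo q x ≡ upsTo p x
  same-count = subst (λ t → upsTo q t ≡ upsTo p t) dip (upsTo-πα-odd a p (upsTo p x))
  dip′ : Dip q x
  dip′ = subst (λ u → suc (double u) ≡ x) (sym same-count) dip
  unique′ : ∀ y → y ≤ 2 * n → Below q y → y ≡ x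
  unique′ y y≤ below with parity y
  ... | j     , inj₂ refl = unique y y≤ (subst (λ u → double u < y) (upsTo-πα-odd a p j) below)
  ... | zero  , inj₁ refl = contradiction below (λ ())
  ... | suc j , inj₁ refl with m≤n⇒m<n∨m≡n y≤
  ...   | inj₂ y≡2n = contradiction (subst (Below q) y≡2n below) (balanced-¬below-end (πα-balanced a p bal))
  ...   | inj₁ y<2n = contradiction (trans left (sym right)) (λ e → <-irrefl e (s≤s (n≤1+n _)))
    where
    v≤j : upsTo q (double (suc j)) ≤ j
    v≤j = double<⇒ _ j below
    left : suc (double j) ≡ x
    left = unique _ (≤-trans (n≤1+n _) y≤)
      (s≤s (double-mono (≤-trans (proj₁ (upsTo-πα-even a p j)) v≤j)))
    right : suc (double (suc j)) ≡ x
    right = unique _ y<2n (s≤s (double-mono (≤-trans (proj₂ (upsTo-πα-even a p j)) (s≤s v≤j))))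

rc-balanced : ∀ {n} p → Balanced n p → Balanced n (rc p)
rc-balanced {n} p (len , up) =
  trans (length-map not (reverse p)) (trans (length-reverse p) len) ,
  +-cancelʳ-≡ n (ups (rc p)) n (begin
    ups (rc p) + n                ≡⟨ cong (_+_ (ups (rc p))) (trans (ups-reverse p) up) ⟨
    ups (rc p) + ups (reverse p)  ≡⟨ ups-map-not (reverse p) ⟩
    length (reverse p)            ≡⟨ trans (length-reverse p) len ⟩
    2 * n                         ≡⟨ cong (_+_ n) (+-identityʳ n) ⟩
    n + n                         ∎)
  where open ≡-Reasoning

rc-mirror : ∀ {n} p k k′ → Balanced n p → k + k′ ≡ 2 * n →
  double (upsTo (rc p) k) + k′ ≡ double (upsTo p k′) + k
rc-mirror {n} p k k′ (len , up) kk′ =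
  arith (upsTo (rc p) k) (upsTo p k′) (trans (cong (_+_ (upsTo (rc p) k)) (sym up))
    (trans (upsTo-rc p k k≤) (cong (λ t → k + upsTo p t) (trans (cong (_∸ k) len) k′≡))))
  where
  k≤ : k ≤ length p
  k≤ = ≤-trans (m≤m+n k k′) (≤-reflexive (trans kk′ (sym len)))
  k′≡ : 2 * n ∸ k ≡ k′
  k′≡ = trans (cong (_∸ k) (sym kk′)) (m+n∸m≡n k k′)
  arith : ∀ u v → u + n ≡ k + v → double u + k′ ≡ double v + k
  arith u v e = +-cancelʳ-≡ (2 * n) _ _ (begin
      double u + k′ + 2 * n  ≡⟨ cong (λ t → t + k′ + 2 * n) (double≡2* u) ⟩
      2 * u + k′ + 2 * n     ≡⟨ regroup₁ u k′ n ⟩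
      2 * (u + n) + k′       ≡⟨ cong (λ t → 2 * t + k′) e ⟩
      2 * (k + v) + k′       ≡⟨ regroup₂ k v k′ ⟩
      2 * v + k + (k + k′)   ≡⟨ cong₂ (λ s t → s + k + t) (sym (double≡2* v)) kk′ ⟩
      double v + k + 2 * n   ∎)
    where
    open ≡-Reasoning
    regroup₁ : ∀ u k′ n → 2 * u + k′ + 2 * n ≡ 2 * (u + n) + k′
    regroup₁ = solve-∀
    regroup₂ : ∀ k v k′ → 2 * (k + v) + k′ ≡ 2 * v + k + (k + k′)
    regroup₂ = solve-∀

-- Nonnegativity at 2n − x transfers to nonnegativity at x.
rc-isDyck : ∀ {n} p → IsDyck n p → IsDyck n (rc p)
rc-isDyck {n} p (bal , above) = rc-balanced p bal , λ x x≤ →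
  balance-≤ (rc-mirror p x (2 * n ∸ x) bal (m+[n∸m]≡n x≤)) (above _ (m∸n≤m _ x))

-- The dip moves to the mirror abscissa 2n − x.
rc-isDyck₋ : ∀ {n} p → IsDyck₋ n p → IsDyck₋ n (rc p)
rc-isDyck₋ {n} p (bal , x , 1≤x , x≤ , dip , unique) =
  rc-balanced p bal , 2 * n ∸ x , m<n⇒0<n∸m x<2n , m∸n≤m _ x ,
  balance-suc (rc-mirror p (2 * n ∸ x) x bal (m∸n+n≡m x≤)) dip , unique′
  where
  x<2n : x < 2 * n
  x<2n = ≤∧≢⇒< x≤ λ x≡2n → balanced-¬below-end bal (subst (Below p) x≡2n (≤-reflexive dip))
  unique′ : ∀ y → y ≤ 2 * n → Below (rc p) y → y ≡ 2 * n ∸ x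
  unique′ y y≤ below = trans (sym (m∸[m∸n]≡n y≤)) (cong (2 * n ∸_)
    (unique _ (m∸n≤m _ y) (balance-< (rc-mirror p y (2 * n ∸ y) bal (m+[n∸m]≡n y≤)) below)))

fα-InD0 : ∀ n a p → 1 ≤ n → InD0 n p → InD0 n (fα a p)
fα-InD0 n a p 1≤n d =
  IsDyck⇒InD0 n _ 1≤n (rc-isDyck _ (πα-isDyck a p (InD0⇒IsDyck n p d)))

fα-InDminus : ∀ n a p → InDminus n p → InDminus n (fα a p)
fα-InDminus n a p d =
  IsDyck₋⇒InDminus n _ (rc-isDyck₋ _ (πα-isDyck₋ a p (InDminus⇒IsDyck₋ n p d)))

imageEq-from-section : ∀ (D : List Bool → Set) (f g : List Bool → List Bool) →
  (∀ p → D p → D (f p)) → (∀ q → D q → D (g q)) → (∀ q → D q → f (g q) ≡ q) → ImageEq f D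
imageEq-from-section D f g f-pres g-pres section =
  f-pres , λ q d → g q , g-pres q d , section q d

lemma9 : (n : ℕ) → 1 ≤ n → (α : Vec Bool (n ∸ 1)) →
    ImageEq (fα (toList α)) (InD0 n) × ImageEq (fα (toList α)) (InDminus n)
lemma9 (suc m) 1≤n α =
  imageEq-from-section (InD0 n) (fα a) (fα (reverse a))
    (λ p → fα-InD0 n a p 1≤n) (λ q → fα-InD0 n (reverse a) q 1≤n) (λ q d → section q (proj₁ d)) ,
  imageEq-from-section (InDminus n) (fα a) (fα (reverse a))
    (fα-InDminus n a) (fα-InDminus n (reverse a)) (λ q d → section q (proj₁ d))
  where
  n : ℕ
  n = suc m
  a : List Bool
  a = toList α
  section : ∀ q → length q ≡ 2 * n → fα a (fα (reverse a) q) ≡ q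
  section q len = fα-section a q
    (trans len (trans (sym (double≡2* n)) (cong (suc ∘ suc ∘ double) (sym (length-toList α)))))
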